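{- Let $G$ be an edge-coloured graph on $n$ vertices with colouring $c$, and let $H$ be a digraph on $V(G)$ such that: $\delta^+(H) \ge \delta^c(G) - \sqrt{n}$; the base graph of $H$ is a subgraph of $G$; for every $u \in V(H)$ the edges $uw$, $w \in N^+_H(u)$, all have distinct colours; for every arc $uv \in E(H)$ there are at most $\sqrt{n}$ vertices $w \in N^-_H(u)$ with $c(uv) = c(uw)$; and for every $v \in V(G)$ the number of pairs $(x,y) \in V(G)\times V(G)$ with $xv, vy \in E(H)$ and $c(xv) = c(vy)$ is at most $n$. Then there are at most $3n^2$ sets $S$ of three vertices such that $H[S] \in \mathcal{K}_{3,1}(H)$ but $G[S]$ is not a rainbow $K_3$. Moreover, for each $v \in V(H)$, there are at most $3n^{3/2}$ such sets $S$ with $v \in S$.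
   Context: An edge-coloured graph is a simple graph with a colouring $c$ of its edges; $\delta^c(G)$ is the minimum over vertices of the number of distinct colours on incident edges. A digraph has no loops and at most one arc per ordered pair (arcs in both directions allowed); $N^+_H$, $N^-_H$ are out- and in-neighbourhoods and $\delta^+$ is minimum out-degree. The base graph of a digraph is the undirected graph with an edge $xy$ whenever $xy$ or $yx$ is an arc. For a 3-set $S$, $H[S] \in \mathcal{K}_{3,1}(H)$ means the induced subdigraph $H[S]$ has base graph a triangle and every vertex of $S$ has an out-neighbour in $S$. $G[S]$ is a rainbow $K_3$ if $S$ spans a triangle in $G$ whose three edges have distinct colours. -}

module Defs where

open import Data.Bool using (Bool; true; false; _∧_; _∨_; not; if_then_else_; T?)
open import Data.Nat using (ℕ; zero; suc; _⊓_; _≡ᵇ_; _<ᵇ_)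
open import Data.Fin using (Fin; toℕ)
import Data.Fin as F
open import Data.List using (List; map; filter; length; allFin; deduplicateᵇ)
open import Data.Nat.ListAction using (sum)
open import Relation.Binary.PropositionalEquality using (_≡_)
open import Function using (_∘_)

-- Vertex set V = Fin n.
-- Edge-coloured simple graph: symmetric irreflexive (decidable) adjacency
-- and a symmetric colouring of pairs (only its values on edges matter).
record ECGraph (n : ℕ) : Set where
  field
    adj       : Fin n → Fin n → Bool
    adj-sym   : ∀ x y → adj x y ≡ adj y x
    adj-irr   : ∀ x → adj x x ≡ false
    col       : Fin n → Fin n → ℕ
    col-sym   : ∀ x y → col x y ≡ col y x
open ECGraph public

record Digraph (n : ℕ) : Set where
  field
    arc     : Fin n → Fin n → Bool
    arc-irr : ∀ x → arc x x ≡ false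
open Digraph public

countF : ∀ {n} → (Fin n → Bool) → ℕ
countF {n} p = sum (map (λ x → if p x then 1 else 0) (allFin n))

-- minimum over all vertices (0 for the empty vertex set)
minF : ∀ {n} → (Fin n → ℕ) → ℕ
minF {zero} f = 0
minF {suc zero} f = f F.zero
minF {suc (suc n)} f = f F.zero ⊓ minF (f ∘ F.suc)

colourDeg : ∀ {n} → ECGraph n → Fin n → ℕ
colourDeg {n} G v = length (deduplicateᵇ _≡ᵇ_ (map (col G v) (filter (λ w → T? (adj G v w)) (allFin n))))

minColourDeg : ∀ {n} → ECGraph n → ℕ
minColourDeg G = minF (colourDeg G)

outDeg : ∀ {n} → Digraph n → Fin n → ℕ
outDeg H v = countF (arc H v)

minOutDeg : ∀ {n} → Digraph n → ℕ
minOutDeg H = minF (outDeg H)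

baseAdj : ∀ {n} → Digraph n → Fin n → Fin n → Bool
baseAdj H x y = arc H x y ∨ arc H y x

-- H[{x,y,z}] ∈ K_{3,1}(H): base graph a triangle, every vertex has an
-- out-neighbour inside S
K31 : ∀ {n} → Digraph n → Fin n → Fin n → Fin n → Bool
K31 H x y z =
  baseAdj H x y ∧ baseAdj H y z ∧ baseAdj H x z ∧
  (arc H x y ∨ arc H x z) ∧ (arc H y x ∨ arc H y z) ∧ (arc H z x ∨ arc H z y)

rainbowK3 : ∀ {n} → ECGraph n → Fin n → Fin n → Fin n → Bool
rainbowK3 G x y z =
  adj G x y ∧ adj G y z ∧ adj G x z ∧
  not (col G x y ≡ᵇ col G y z) ∧ not (col G x y ≡ᵇ col G x z) ∧ not (col G y z ≡ᵇ col G x z)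

bad : ∀ {n} → ECGraph n → Digraph n → Fin n → Fin n → Fin n → Bool
bad G H x y z = K31 H x y z ∧ not (rainbowK3 G x y z)

sumF : ∀ {n} → (Fin n → ℕ) → ℕ
sumF {n} f = sum (map f (allFin n))

-- number of 3-sets {x,y,z} (enumerated once, as x < y < z) satisfying p
count3Sets : ∀ {n} → (Fin n → Fin n → Fin n → Bool) → ℕ
count3Sets p = sumF λ x → sumF λ y → countF λ z →
  (toℕ x <ᵇ toℕ y) ∧ (toℕ y <ᵇ toℕ z) ∧ p x y z

inS : ∀ {n} → Fin n → Fin n → Fin n → Fin n → Bool
inS v x y z = (toℕ v ≡ᵇ toℕ x) ∨ (toℕ v ≡ᵇ toℕ y) ∨ (toℕ v ≡ᵇ toℕ z)

{-# OPTIONS --safe #-}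
-- If S = {x, y, z} spans a triangle in the base graph of H and every vertex of S has an
-- out-neighbour in S, but G[S] is not rainbow, then two edges of S at some vertex c share a
-- colour.  The out-arcs at c have distinct colours, so c has an arc to exactly one of the
-- other two, say b, and the remaining vertex a has an arc to c: a → c → b is a monochromatic
-- directed path of H inside S.  Hence there are no more bad sets than monochromatic 2-paths,
-- and at most n of these have any given centre.  A set through v contains such a path
-- with v as its start (at most one per centre, by distinct out-colours), as its centre
-- (at most n), or as its end (at most √n per centre).
module Submission where

open import Defs
import Algebra.Properties.Semiring.Sum
open import Data.Bool using (Bool; true; false; _∧_; _∨_; if_then_else_)
open import Data.Bool.Properties using (∨-assoc; ∨-comm; ∧-conicalˡ; ∧-conicalʳ; not-injective; ¬-not; T-≡)
open import Data.Fin using (Fin; toℕ; zero; suc)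
import Data.Fin.Properties as Fin
open import Data.List using (tabulate)
open import Data.List.Properties using (map-tabulate)
import Data.Nat.ListAction as List
open import Data.Nat using (ℕ; zero; suc; _+_; _*_; _^_; _∸_; _⊔_; _≤_; _<_; _<ᵇ_; _≡ᵇ_; z≤n; s≤s)
open import Data.Nat.Properties
open import Data.Nat.Tactic.RingSolver using (solve-∀)
open import Data.Product using (_×_; _,_)
open import Data.Sum using (_⊎_; inj₁; inj₂)
open import Data.Vec.Functional using (foldr)
open import Function using (_∘_; id; case_of_; Equivalence)
open import Relation.Binary.Definitions using (tri<; tri≈; tri>)
open import Relation.Binary.PropositionalEquality
open import Relation.Nullary using (contradiction)

open Algebra.Properties.Semiring.Sum +-*-semiring
  using (sum; sum-syntax; ∑-distrib-+; ∑-comm; sum-cong-≗; sum-replicate-zero)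

private variable
  n : ℕ

𝟙 : Bool → ℕ
𝟙 b = if b then 1 else 0

𝟙-≤ : ∀ {b m} → (b ≡ true → 1 ≤ m) → 𝟙 b ≤ m
𝟙-≤ {false} _ = z≤n
𝟙-≤ {true} 1≤m = 1≤m refl

𝟙-mono : ∀ {a b} → (a ≡ true → b ≡ true) → 𝟙 a ≤ 𝟙 b
𝟙-mono a⇒b = 𝟙-≤ λ a → ≤-reflexive (cong 𝟙 (sym (a⇒b a)))

𝟙-∨₃-∧ : ∀ α β γ w → 𝟙 ((α ∨ β ∨ γ) ∧ w) ≤ 𝟙 (α ∧ w) + 𝟙 (β ∧ w) + 𝟙 (γ ∧ w)
𝟙-∨₃-∧ true  β     γ w = ≤-trans (m≤m+n (𝟙 w) _) (m≤m+n _ _)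
𝟙-∨₃-∧ false true  γ w = m≤m+n (𝟙 w) _
𝟙-∨₃-∧ false false γ w = ≤-refl

𝟙-weight-≤1 : ∀ k t m → (t ≡ true → k ≤ 1) → k * (𝟙 t * m) ≤ 𝟙 t * m
𝟙-weight-≤1 k false m _   = ≤-reflexive (*-zeroʳ k)
𝟙-weight-≤1 k true  m k≤1 = ≤-trans (*-monoˡ-≤ _ (k≤1 refl)) (≤-reflexive (*-identityˡ _))

∧-split : ∀ {a b} → a ∧ b ≡ true → a ≡ true × b ≡ true
∧-split {true} b = refl , b

∧-intro : ∀ {a b} → a ≡ true → b ≡ true → a ∧ b ≡ true
∧-intro refl b = b

≡ᵇ-true⇒≡ : ∀ m n → (m ≡ᵇ n) ≡ true → m ≡ n
≡ᵇ-true⇒≡ m n e = ≡ᵇ⇒≡ m n (Equivalence.from T-≡ e)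

≡⇒≡ᵇ-true : ∀ {m n} → m ≡ n → (m ≡ᵇ n) ≡ true
≡⇒≡ᵇ-true {m} {n} e = Equivalence.to T-≡ (≡⇒≡ᵇ m n e)

<ᵇ-true⇒< : ∀ m n → (m <ᵇ n) ≡ true → m < n
<ᵇ-true⇒< m n e = <ᵇ⇒< m n (Equivalence.from T-≡ e)

<⇒<ᵇ-true : ∀ {m n} → m < n → (m <ᵇ n) ≡ true
<⇒<ᵇ-true m<n = Equivalence.to T-≡ (<⇒<ᵇ m<n)

≤⇒<ᵇ-false : ∀ {m n} → n ≤ m → (m <ᵇ n) ≡ false
≤⇒<ᵇ-false {m} {n} n≤m = ¬-not (λ m<n → ≤⇒≯ n≤m (<ᵇ-true⇒< m n m<n))

𝟙-<ᵇ-asym : ∀ m n → 𝟙 (m <ᵇ n) + 𝟙 (n <ᵇ m) ≤ 1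
𝟙-<ᵇ-asym zero    zero    = z≤n
𝟙-<ᵇ-asym zero    (suc n) = ≤-refl
𝟙-<ᵇ-asym (suc m) zero    = ≤-refl
𝟙-<ᵇ-asym (suc m) (suc n) = 𝟙-<ᵇ-asym m n

𝟙-position-unique : ∀ a b c → a < b →
  𝟙 ((c <ᵇ a) ∧ (a <ᵇ b)) + 𝟙 ((a <ᵇ c) ∧ (c <ᵇ b)) + 𝟙 ((a <ᵇ b) ∧ (b <ᵇ c)) ≤ 1
𝟙-position-unique a b c a<b with <-cmp c a
... | tri< c<a _ _
  rewrite <⇒<ᵇ-true c<a | <⇒<ᵇ-true a<b | ≤⇒<ᵇ-false (<⇒≤ c<a)
        | ≤⇒<ᵇ-false (<⇒≤ (<-trans c<a a<b)) = ≤-refl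
... | tri≈ _ refl _
  rewrite ≤⇒<ᵇ-false (≤-refl {a}) | <⇒<ᵇ-true a<b | ≤⇒<ᵇ-false (<⇒≤ a<b) = z≤n
... | tri> _ _ a<c
  rewrite <⇒<ᵇ-true a<c | ≤⇒<ᵇ-false (<⇒≤ a<c) | <⇒<ᵇ-true a<b = 𝟙-<ᵇ-asym c b

sum-tabulate : ∀ (f : Fin n → ℕ) → List.sum (tabulate f) ≡ ∑[ i < n ] f i
sum-tabulate {zero}  f = refl
sum-tabulate {suc n} f = cong (f zero +_) (sum-tabulate (f ∘ suc))

sumF≡∑ : ∀ (f : Fin n → ℕ) → sumF f ≡ ∑[ i < n ] f i
sumF≡∑ f = trans (cong List.sum (map-tabulate id f)) (sum-tabulate f)

∑-mono-≤ : ∀ {f g : Fin n → ℕ} → (∀ i → f i ≤ g i) → ∑[ i < n ] f i ≤ ∑[ i < n ] g i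
∑-mono-≤ {zero}  _   = z≤n
∑-mono-≤ {suc n} f≤g = +-mono-≤ (f≤g zero) (∑-mono-≤ (f≤g ∘ suc))

∑-≤-* : ∀ {f : Fin n → ℕ} {m} → (∀ i → f i ≤ m) → ∑[ i < n ] f i ≤ n * m
∑-≤-* {zero}  _   = z≤n
∑-≤-* {suc n} f≤m = +-mono-≤ (f≤m zero) (∑-≤-* (f≤m ∘ suc))

∑-𝟙-none : ∀ {p : Fin n → Bool} → (∀ i → p i ≢ true) → ∑[ i < n ] 𝟙 (p i) ≡ 0
∑-𝟙-none {n} ¬p = trans (sum-cong-≗ λ i → cong 𝟙 (¬-not (¬p i))) (sum-replicate-zero n)

∑-𝟙-unique : ∀ {p : Fin n → Bool} → (∀ i j → p i ≡ true → p j ≡ true → i ≡ j) →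
  ∑[ i < n ] 𝟙 (p i) ≤ 1
∑-𝟙-unique {zero}      _      = z≤n
∑-𝟙-unique {suc n} {p} unique with p zero in p₀
... | true  = ≤-reflexive (cong suc (∑-𝟙-none λ i pᵢ → Fin.0≢1+n (unique zero (suc i) p₀ pᵢ)))
... | false = ∑-𝟙-unique λ i j pᵢ pⱼ → Fin.suc-injective (unique (suc i) (suc j) pᵢ pⱼ)

∑-δ : ∀ (v : Fin n) (p : Fin n → Bool) → ∑[ i < n ] 𝟙 ((toℕ v ≡ᵇ toℕ i) ∧ p i) ≡ 𝟙 (p v)
∑-δ {suc n} zero    p = trans (cong (𝟙 (p zero) +_) (sum-replicate-zero n)) (+-identityʳ _)
∑-δ {suc n} (suc v) p = ∑-δ v (p ∘ suc)

⨆ : (Fin n → ℕ) → ℕ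
⨆ = foldr _⊔_ 0

≤-⨆ : ∀ (f : Fin n → ℕ) i → f i ≤ ⨆ f
≤-⨆ f zero    = m≤m⊔n _ _
≤-⨆ f (suc i) = ≤-trans (≤-⨆ (f ∘ suc) i) (m≤n⊔m _ _)

⨆-closed : ∀ (P : ℕ → Set) (f : Fin n → ℕ) → P 0 → (∀ i → P (f i)) → P (⨆ f)
⨆-closed {zero}  P f P0 Pf = P0
⨆-closed {suc n} P f P0 Pf with ⊔-sel (f zero) (⨆ (f ∘ suc))
... | inj₁ ⨆≡f₀ = subst P (sym ⨆≡f₀) (Pf zero)
... | inj₂ ⨆≡⨆′ = subst P (sym ⨆≡⨆′) (⨆-closed P (f ∘ suc) P0 (Pf ∘ suc))

∑³ : (Fin n → Fin n → Fin n → ℕ) → ℕ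
∑³ {n} F = ∑[ x < n ] ∑[ y < n ] ∑[ z < n ] F x y z

∑³-cong : ∀ {F G : Fin n → Fin n → Fin n → ℕ} →
  (∀ x y z → F x y z ≡ G x y z) → ∑³ F ≡ ∑³ G
∑³-cong F≡G = sum-cong-≗ λ x → sum-cong-≗ λ y → sum-cong-≗ λ z → F≡G x y z

∑³-mono-≤ : ∀ {F G : Fin n → Fin n → Fin n → ℕ} →
  (∀ x y z → F x y z ≤ G x y z) → ∑³ F ≤ ∑³ G
∑³-mono-≤ F≤G = ∑-mono-≤ λ x → ∑-mono-≤ λ y → ∑-mono-≤ λ z → F≤G x y z

∑³-distrib-+ : ∀ (F G : Fin n → Fin n → Fin n → ℕ) →
  ∑³ (λ x y z → F x y z + G x y z) ≡ ∑³ F + ∑³ G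
∑³-distrib-+ {n} F G =
  trans (sum-cong-≗ λ x → trans (sum-cong-≗ λ y → ∑-distrib-+ (F x y) (G x y))
                                (∑-distrib-+ (λ y → ∑[ z < n ] F x y z) (λ y → ∑[ z < n ] G x y z)))
        (∑-distrib-+ (λ x → ∑[ y < n ] ∑[ z < n ] F x y z) (λ x → ∑[ y < n ] ∑[ z < n ] G x y z))

∑³-distrib-+₃ : ∀ (F G K : Fin n → Fin n → Fin n → ℕ) →
  ∑³ (λ x y z → F x y z + G x y z + K x y z) ≡ ∑³ F + ∑³ G + ∑³ K
∑³-distrib-+₃ F G K = trans (∑³-distrib-+ _ K) (cong (_+ ∑³ K) (∑³-distrib-+ F G))

∑³-swap₁₂ : ∀ (F : Fin n → Fin n → Fin n → ℕ) → ∑³ F ≡ ∑³ (λ x y z → F y x z)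
∑³-swap₁₂ {n} F = ∑-comm λ x y → ∑[ z < n ] F x y z

∑³-swap₂₃ : ∀ (F : Fin n → Fin n → Fin n → ℕ) → ∑³ F ≡ ∑³ (λ x y z → F x z y)
∑³-swap₂₃ F = sum-cong-≗ λ x → ∑-comm (F x)

∑³-rotate : ∀ (F : Fin n → Fin n → Fin n → ℕ) → ∑³ F ≡ ∑³ (λ x y z → F z x y)
∑³-rotate F = trans (∑³-swap₁₂ F) (∑³-swap₂₃ λ x y z → F y x z)

_≺_ : Fin n → Fin n → Bool
x ≺ y = toℕ x <ᵇ toℕ y

count3Sets≡∑³ : ∀ (p : Fin n → Fin n → Fin n → Bool) →
  count3Sets p ≡ ∑³ (λ x y z → 𝟙 ((x ≺ y) ∧ (y ≺ z) ∧ p x y z))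
count3Sets≡∑³ {n} p =
  trans (sumF≡∑ λ x → sumF λ y → countF (increasing x y))
        (sum-cong-≗ λ x → trans (sumF≡∑ λ y → countF (increasing x y))
                                (sum-cong-≗ λ y → sumF≡∑ λ z → 𝟙 (increasing x y z)))
  where
  increasing : Fin n → Fin n → Fin n → Bool
  increasing x y z = (x ≺ y) ∧ (y ≺ z) ∧ p x y z

∑²-ordered-pairs-≤ : ∀ (f : Fin n → Fin n → ℕ) →
  ∑[ a < n ] ∑[ b < n ] (𝟙 (a ≺ b) * (f a b + f b a)) ≤ ∑[ a < n ] ∑[ b < n ] f a b
∑²-ordered-pairs-≤ {n} f = begin
  ∑² (λ a b → 𝟙 (a ≺ b) * (f a b + f b a))
    ≡⟨ ∑²-cong (λ a b → *-distribˡ-+ (𝟙 (a ≺ b)) (f a b) (f b a)) ⟩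
  ∑² (λ a b → below a b + above b a)
    ≡⟨ ∑²-distrib-+ below (λ a b → above b a) ⟩
  ∑² below + ∑² (λ a b → above b a)
    ≡⟨ cong (∑² below +_) (∑-comm λ a b → above b a) ⟩
  ∑² below + ∑² above
    ≡⟨ ∑²-distrib-+ below above ⟨
  ∑² (λ a b → below a b + above a b)
    ≡⟨ ∑²-cong (λ a b → *-distribʳ-+ (f a b) (𝟙 (a ≺ b)) (𝟙 (b ≺ a))) ⟨
  ∑² (λ a b → (𝟙 (a ≺ b) + 𝟙 (b ≺ a)) * f a b)
    ≤⟨ ∑-mono-≤ (λ a → ∑-mono-≤ λ b → at-most-once a b) ⟩
  ∑² f ∎
  where
  open ≤-Reasoning
  ∑² : (Fin n → Fin n → ℕ) → ℕ
  ∑² g = ∑[ a < n ] ∑[ b < n ] g a b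
  ∑²-cong : ∀ {g h : Fin n → Fin n → ℕ} → (∀ a b → g a b ≡ h a b) → ∑² g ≡ ∑² h
  ∑²-cong g≡h = sum-cong-≗ λ a → sum-cong-≗ (g≡h a)
  ∑²-distrib-+ : ∀ (g h : Fin n → Fin n → ℕ) → ∑² (λ a b → g a b + h a b) ≡ ∑² g + ∑² h
  ∑²-distrib-+ g h = trans (sum-cong-≗ λ a → ∑-distrib-+ (g a) (h a))
                           (∑-distrib-+ (λ a → ∑[ b < n ] g a b) _)
  below above : Fin n → Fin n → ℕ
  below a b = 𝟙 (a ≺ b) * f a b
  above a b = 𝟙 (b ≺ a) * f a b
  at-most-once : ∀ a b → (𝟙 (a ≺ b) + 𝟙 (b ≺ a)) * f a b ≤ f a b
  at-most-once a b = ≤-trans (*-monoˡ-≤ (f a b) (𝟙-<ᵇ-asym (toℕ a) (toℕ b)))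
                             (≤-reflexive (*-identityˡ _))

∑³-by-centre : ∀ (R E : Fin n → Fin n → Fin n → ℕ) →
  ∑³ (λ x y z → R x y z * (E x y z + E y x z + E z x y)) ≡
  ∑³ (λ c a b → (R c a b + R a c b + R a b c) * E c a b)
∑³-by-centre {n} R E = begin
  ∑³ (λ x y z → R x y z * (E x y z + E y x z + E z x y))
    ≡⟨ ∑³-cong (λ x y z → *-distribˡ-+₃ (R x y z) (E x y z) (E y x z) (E z x y)) ⟩
  ∑³ (λ x y z → F₁ x y z + F₂ y x z + F₃ z x y)
    ≡⟨ ∑³-distrib-+₃ F₁ (λ x y z → F₂ y x z) (λ x y z → F₃ z x y) ⟩
  ∑³ F₁ + ∑³ (λ x y z → F₂ y x z) + ∑³ (λ x y z → F₃ z x y)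
    ≡⟨ cong₂ (λ s t → ∑³ F₁ + s + t) (∑³-swap₁₂ F₂) (∑³-rotate F₃) ⟨
  ∑³ F₁ + ∑³ F₂ + ∑³ F₃
    ≡⟨ ∑³-distrib-+₃ F₁ F₂ F₃ ⟨
  ∑³ (λ c a b → F₁ c a b + F₂ c a b + F₃ c a b)
    ≡⟨ ∑³-cong (λ c a b → *-distribʳ-+₃ (E c a b) (R c a b) (R a c b) (R a b c)) ⟨
  ∑³ (λ c a b → (R c a b + R a c b + R a b c) * E c a b) ∎
  where
  open ≡-Reasoning
  F₁ F₂ F₃ : Fin n → Fin n → Fin n → ℕ
  F₁ c a b = R c a b * E c a b
  F₂ c a b = R a c b * E c a b
  F₃ c a b = R a b c * E c a b
  *-distribˡ-+₃ : ∀ k a b c → k * (a + b + c) ≡ k * a + k * b + k * c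
  *-distribˡ-+₃ = solve-∀
  *-distribʳ-+₃ : ∀ k a b c → (a + b + c) * k ≡ a * k + b * k + c * k
  *-distribʳ-+₃ = solve-∀

≺⇒< : ∀ (x y : Fin n) → x ≺ y ≡ true → toℕ x < toℕ y
≺⇒< x y = <ᵇ-true⇒< (toℕ x) (toℕ y)

≺⇒≢ : ∀ (x y : Fin n) → x ≺ y ≡ true → x ≢ y
≺⇒≢ x y x≺y refl = <-irrefl refl (≺⇒< x y x≺y)

≺-trans : ∀ (x y z : Fin n) → x ≺ y ≡ true → y ≺ z ≡ true → x ≺ z ≡ true
≺-trans x y z x≺y y≺z = <⇒<ᵇ-true (<-trans (≺⇒< x y x≺y) (≺⇒< y z y≺z))

-- P a c b ≡ true reads: a – c – b is a path with centre c and ends a, b.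
Centred : (Fin n → Fin n → Fin n → Bool) → Fin n → Fin n → Fin n → Set
Centred P c a b = P a c b ≡ true ⊎ P b c a ≡ true

PathOn : (Fin n → Fin n → Fin n → Bool) → Fin n → Fin n → Fin n → Set
PathOn P x y z = Centred P x y z ⊎ Centred P y x z ⊎ Centred P z x y

#paths : (Fin n → Fin n → Fin n → Bool) → ℕ
#paths P = ∑³ (λ c a b → 𝟙 (P a c b))

-- Each 3-set x < y < z is charged to a path on it.  No path c, {a < b} is charged twice:
-- the ends a < b and the position of c below, between or above them fix the sorted triple.
count3Sets-≤-#paths : ∀ (p P : Fin n → Fin n → Fin n → Bool) →
  (∀ x y z → x ≢ y → y ≢ z → x ≢ z → p x y z ≡ true → PathOn P x y z) →
  count3Sets p ≤ #paths P
count3Sets-≤-#paths {n} p P path = begin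
  count3Sets p
    ≡⟨ count3Sets≡∑³ p ⟩
  ∑³ (λ x y z → 𝟙 ((x ≺ y) ∧ (y ≺ z) ∧ p x y z))
    ≤⟨ ∑³-mono-≤ (λ x y z → 𝟙-≤ (covered x y z)) ⟩
  ∑³ (λ x y z → R x y z * (E x y z + E y x z + E z x y))
    ≡⟨ ∑³-by-centre R E ⟩
  ∑³ (λ c a b → (R c a b + R a c b + R a b c) * E c a b)
    ≤⟨ ∑³-mono-≤ one-position ⟩
  ∑³ E
    ≤⟨ ∑-mono-≤ (λ c → ∑²-ordered-pairs-≤ λ a b → 𝟙 (P a c b)) ⟩
  #paths P ∎
  where
  open ≤-Reasoning
  R E : Fin n → Fin n → Fin n → ℕ
  R x y z = 𝟙 ((x ≺ y) ∧ (y ≺ z))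
  E c a b = 𝟙 (a ≺ b) * (𝟙 (P a c b) + 𝟙 (P b c a))

  one-position : ∀ c a b → (R c a b + R a c b + R a b c) * E c a b ≤ E c a b
  one-position c a b = 𝟙-weight-≤1 (R c a b + R a c b + R a b c) (a ≺ b) (𝟙 (P a c b) + 𝟙 (P b c a))
    λ a≺b → 𝟙-position-unique (toℕ a) (toℕ b) (toℕ c) (≺⇒< a b a≺b)

  1≤E : ∀ c a b → a ≺ b ≡ true → Centred P c a b → 1 ≤ E c a b
  1≤E c a b a≺b centred rewrite a≺b | *-identityˡ (𝟙 (P a c b) + 𝟙 (P b c a)) with centred
  ... | inj₁ P-acb rewrite P-acb = s≤s z≤n
  ... | inj₂ P-bca rewrite P-bca = m≤n+m 1 _

  1≤E₃ : ∀ x y z → x ≺ y ≡ true → y ≺ z ≡ true → PathOn P x y z →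
    1 ≤ E x y z + E y x z + E z x y
  1≤E₃ x y z x≺y y≺z (inj₁ at-x) =
    ≤-trans (1≤E x y z y≺z at-x) (≤-trans (m≤m+n (E x y z) (E y x z)) (m≤m+n _ (E z x y)))
  1≤E₃ x y z x≺y y≺z (inj₂ (inj₁ at-y)) =
    ≤-trans (1≤E y x z (≺-trans x y z x≺y y≺z) at-y)
            (≤-trans (m≤n+m (E y x z) (E x y z)) (m≤m+n _ (E z x y)))
  1≤E₃ x y z x≺y y≺z (inj₂ (inj₂ at-z)) =
    ≤-trans (1≤E z x y x≺y at-z) (m≤n+m (E z x y) (E x y z + E y x z))

  covered : ∀ x y z → (x ≺ y) ∧ (y ≺ z) ∧ p x y z ≡ true →
    1 ≤ R x y z * (E x y z + E y x z + E z x y)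
  covered x y z increasing-p =
    let x≺y , y≺z∧p = ∧-split increasing-p
        y≺z , pxyz  = ∧-split y≺z∧p
        x≺z         = ≺-trans x y z x≺y y≺z
        Rxyz≡1      = cong 𝟙 (∧-intro x≺y y≺z)
    in subst (1 ≤_) (sym (trans (cong (_* (E x y z + E y x z + E z x y)) Rxyz≡1) (*-identityˡ _)))
             (1≤E₃ x y z x≺y y≺z
                   (path x y z (≺⇒≢ x y x≺y) (≺⇒≢ y z y≺z) (≺⇒≢ x z x≺z) pxyz))

Symmetric₃ : (Fin n → Fin n → Fin n → Bool) → Set
Symmetric₃ q = (∀ x y z → q x y z ≡ q y x z) × (∀ x y z → q x y z ≡ q x z y)

inS-symmetric : ∀ (v : Fin n) → Symmetric₃ (inS v)
inS-symmetric {n} v = (λ x y z → swap-front (v ≐ x) (v ≐ y) (v ≐ z))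
                , (λ x y z → cong ((v ≐ x) ∨_) (∨-comm (v ≐ y) (v ≐ z)))
  where
  _≐_ : Fin n → Fin n → Bool
  v ≐ x = toℕ v ≡ᵇ toℕ x
  swap-front : ∀ a b c → a ∨ b ∨ c ≡ b ∨ a ∨ c
  swap-front a b c = trans (sym (∨-assoc a b c)) (trans (cong (_∨ c) (∨-comm a b)) (∨-assoc b a c))

PathOn-∧ : ∀ (q P : Fin n → Fin n → Fin n → Bool) {x y z} → Symmetric₃ q → q x y z ≡ true →
  PathOn P x y z → PathOn (λ a c b → q a c b ∧ P a c b) x y z
PathOn-∧ q P {x} {y} {z} (s₁₂ , s₂₃) q-xyz path = case path of λ where
    (inj₁ (inj₁ P-yxz))        → inj₁ (inj₁ (∧-intro q-yxz P-yxz))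
    (inj₁ (inj₂ P-zxy))        → inj₁ (inj₂ (∧-intro q-zxy P-zxy))
    (inj₂ (inj₁ (inj₁ P-xyz))) → inj₂ (inj₁ (inj₁ (∧-intro q-xyz P-xyz)))
    (inj₂ (inj₁ (inj₂ P-zyx))) → inj₂ (inj₁ (inj₂ (∧-intro q-zyx P-zyx)))
    (inj₂ (inj₂ (inj₁ P-xzy))) → inj₂ (inj₂ (inj₁ (∧-intro q-xzy P-xzy)))
    (inj₂ (inj₂ (inj₂ P-yzx))) → inj₂ (inj₂ (inj₂ (∧-intro q-yzx P-yzx)))
  where
  q-yxz : q y x z ≡ true
  q-xzy : q x z y ≡ true
  q-zxy : q z x y ≡ true
  q-yzx : q y z x ≡ true
  q-zyx : q z y x ≡ true
  q-yxz = trans (sym (s₁₂ x y z)) q-xyz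
  q-xzy = trans (sym (s₂₃ x y z)) q-xyz
  q-zxy = trans (sym (s₁₂ x z y)) q-xzy
  q-yzx = trans (sym (s₂₃ y x z)) q-yxz
  q-zyx = trans (sym (s₁₂ y z x)) q-yzx

monoPath : ECGraph n → Digraph n → Fin n → Fin n → Fin n → Bool
monoPath G H a c b = arc H a c ∧ arc H c b ∧ (col G a c ≡ᵇ col G c b)

monoPath-intro : ∀ (G : ECGraph n) (H : Digraph n) {a c b} →
  arc H a c ≡ true → arc H c b ≡ true → col G a c ≡ col G c b → monoPath G H a c b ≡ true
monoPath-intro G H a→c c→b same rewrite a→c | c→b = ≡⇒≡ᵇ-true same

monoPath-parts : ∀ (G : ECGraph n) (H : Digraph n) {a c b} → monoPath G H a c b ≡ true →
  arc H a c ≡ true × arc H c b ≡ true × col G a c ≡ col G c b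
monoPath-parts G H {a} {c} {b} path =
  let a→c , c→b∧same = ∧-split path
      c→b , same     = ∧-split c→b∧same
  in a→c , c→b , ≡ᵇ-true⇒≡ (col G a c) (col G c b) same

repeated-colour : ∀ (G : ECGraph n) {x y z} →
  adj G x y ≡ true → adj G y z ≡ true → adj G x z ≡ true → rainbowK3 G x y z ≡ false →
  col G x y ≡ col G x z ⊎ col G x y ≡ col G y z ⊎ col G y z ≡ col G x z
repeated-colour G {x} {y} {z} xy yz xz not-rainbow rewrite xy | yz | xz
  with col G x y ≡ᵇ col G y z in e₁ | col G x y ≡ᵇ col G x z in e₂ | col G y z ≡ᵇ col G x z in e₃
... | _     | true  | _     = inj₁ (≡ᵇ-true⇒≡ _ _ e₂)
... | true  | false | _     = inj₂ (inj₁ (≡ᵇ-true⇒≡ _ _ e₁))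
... | false | false | true  = inj₂ (inj₂ (≡ᵇ-true⇒≡ _ _ e₃))
... | false | false | false = contradiction not-rainbow λ ()

baseAdj-sym : ∀ (H : Digraph n) {x y} → baseAdj H x y ≡ true → baseAdj H y x ≡ true
baseAdj-sym H {x} {y} = trans (∨-comm (arc H y x) (arc H x y))

baseAdj-reverse : ∀ (H : Digraph n) {x y} → baseAdj H x y ≡ true → arc H x y ≡ false → arc H y x ≡ true
baseAdj-reverse H {x} {y} xy x↛y = subst (λ s → s ∨ arc H y x ≡ true) x↛y xy

K31-parts : ∀ (H : Digraph n) {x y z} → K31 H x y z ≡ true →
  baseAdj H x y ≡ true × baseAdj H y z ≡ true × baseAdj H x z ≡ true ×
  (arc H x y ∨ arc H x z) ≡ true × (arc H y x ∨ arc H y z) ≡ true × (arc H z x ∨ arc H z y) ≡ true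
K31-parts H k =
  let xy , k₁   = ∧-split k
      yz , k₂   = ∧-split k₁
      xz , k₃   = ∧-split k₂
      x→ , k₄   = ∧-split k₃
      y→ , z→   = ∧-split k₄
  in xy , yz , xz , x→ , y→ , z→

monoPaths-into-sq-≤ : ∀ (G : ECGraph n) (H : Digraph n) c v →
  (arc H c v ≡ true → countF (λ w → arc H w c ∧ (col G c v ≡ᵇ col G c w)) ^ 2 ≤ n) →
  (∑[ a < n ] 𝟙 (monoPath G H a c v)) ^ 2 ≤ n
monoPaths-into-sq-≤ {n} G H c v bound = by-arc (arc H c v) refl
  where
  m : ℕ
  m = ∑[ a < n ] 𝟙 (monoPath G H a c v)
  in-colour : Fin n → Bool
  in-colour a = arc H a c ∧ (col G c v ≡ᵇ col G c a)
  reversed : ∀ a → monoPath G H a c v ≡ true → in-colour a ≡ true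
  reversed a path = let a→c , _ , same = monoPath-parts G H path
                    in ∧-intro a→c (≡⇒≡ᵇ-true (sym (trans (col-sym G c a) same)))
  m≤in-colour : m ≤ countF in-colour
  m≤in-colour = ≤-trans (∑-mono-≤ λ a → 𝟙-mono (reversed a)) (≤-reflexive (sym (sumF≡∑ (𝟙 ∘ in-colour))))
  by-arc : ∀ t → arc H c v ≡ t → m ^ 2 ≤ n
  by-arc true  c→v = ≤-trans (^-monoˡ-≤ 2 m≤in-colour) (bound c→v)
  by-arc false c→v = subst (λ m → m ^ 2 ≤ n) (sym (∑-𝟙-none no-path)) z≤n
    where
    no-path : ∀ a → monoPath G H a c v ≢ true
    no-path a path = let _ , c→v′ , _ = monoPath-parts G H path
                     in contradiction (trans (sym c→v′) c→v) λ ()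

module BadSets {n} (G : ECGraph n) (H : Digraph n)
  (arc⇒adj : ∀ x y → arc H x y ≡ true → adj G x y ≡ true)
  (out-colours-distinct : ∀ u w w′ → arc H u w ≡ true → arc H u w′ ≡ true →
                          col G u w ≡ col G u w′ → w ≡ w′)
  where

  baseAdj⇒adj : ∀ x y → baseAdj H x y ≡ true → adj G x y ≡ true
  baseAdj⇒adj x y xy with arc H x y in x→y
  ... | true  = arc⇒adj x y x→y
  ... | false = trans (adj-sym G x y) (arc⇒adj y x xy)

  centred : ∀ {c a b} → a ≢ b → baseAdj H c a ≡ true → baseAdj H c b ≡ true →
    (arc H c a ∨ arc H c b) ≡ true → col G c a ≡ col G c b → Centred (monoPath G H) c a b
  centred {c} {a} {b} a≢b ca cb c→a∨c→b same = by-arcs (arc H c a) (arc H c b) refl refl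
    where
    by-arcs : ∀ s t → arc H c a ≡ s → arc H c b ≡ t → Centred (monoPath G H) c a b
    by-arcs true  true  c→a c→b = contradiction (out-colours-distinct c a b c→a c→b same) a≢b
    by-arcs false true  c→a c→b =
      inj₁ (monoPath-intro G H (baseAdj-reverse H ca c→a) c→b (trans (col-sym G a c) same))
    by-arcs true  false c→a c→b =
      inj₂ (monoPath-intro G H (baseAdj-reverse H cb c→b) c→a (trans (col-sym G b c) (sym same)))
    by-arcs false false c→a c→b = contradiction (trans (sym (cong₂ _∨_ c→a c→b)) c→a∨c→b) λ ()

  bad⇒PathOn : ∀ {x y z} → x ≢ y → y ≢ z → x ≢ z → bad G H x y z ≡ true →
    PathOn (monoPath G H) x y z
  bad⇒PathOn {x} {y} {z} x≢y y≢z x≢z is-bad =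
    let xy , yz , xz , x→y∨x→z , y→x∨y→z , z→x∨z→y = K31-parts H (∧-conicalˡ _ _ is-bad)
        not-rainbow = not-injective {y = false} (∧-conicalʳ _ _ is-bad)
        repeated = repeated-colour G (baseAdj⇒adj x y xy) (baseAdj⇒adj y z yz) (baseAdj⇒adj x z xz)
                                     not-rainbow
    in case repeated of λ where
      (inj₁ xy~xz)        → inj₁ (centred y≢z xy xz x→y∨x→z xy~xz)
      (inj₂ (inj₁ xy~yz)) → inj₂ (inj₁ (centred x≢z (baseAdj-sym H xy) yz y→x∨y→z
                                                  (trans (col-sym G y x) xy~yz)))
      (inj₂ (inj₂ yz~xz)) → inj₂ (inj₂ (centred x≢y (baseAdj-sym H xz) (baseAdj-sym H yz) z→x∨z→y
                                                  (trans (col-sym G z x) (trans (sym yz~xz) (col-sym G y z)))))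

  bad-sets-≤-monoPaths : ∀ (q : Fin n → Fin n → Fin n → Bool) → Symmetric₃ q →
    count3Sets (λ x y z → q x y z ∧ bad G H x y z) ≤ #paths (λ a c b → q a c b ∧ monoPath G H a c b)
  bad-sets-≤-monoPaths q q-symmetric =
    count3Sets-≤-#paths (λ x y z → q x y z ∧ bad G H x y z) (λ a c b → q a c b ∧ monoPath G H a c b)
      λ x y z x≢y y≢z x≢z q∧bad →
        let q-xyz , is-bad = ∧-split q∧bad
        in PathOn-∧ q (monoPath G H) q-symmetric q-xyz (bad⇒PathOn x≢y y≢z x≢z is-bad)

  monoPaths-from-≤1 : ∀ v c → ∑[ b < n ] 𝟙 (monoPath G H v c b) ≤ 1
  monoPaths-from-≤1 v c = ∑-𝟙-unique λ b₁ b₂ path₁ path₂ →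
    let _ , c→b₁ , same₁ = monoPath-parts G H path₁
        _ , c→b₂ , same₂ = monoPath-parts G H path₂
    in out-colours-distinct c b₁ b₂ c→b₁ c→b₂ (trans (sym same₁) same₂)

  #paths-through-≤ : ∀ v → (∀ c → ∑[ a < n ] ∑[ b < n ] 𝟙 (monoPath G H a c b) ≤ n) →
    #paths (λ a c b → inS v a c b ∧ monoPath G H a c b) ≤
    n + n + n * ⨆ (λ c → ∑[ a < n ] 𝟙 (monoPath G H a c v))
  #paths-through-≤ v at-centre-≤ = begin
    #paths (λ a c b → inS v a c b ∧ W a c b)
      ≤⟨ ∑³-mono-≤ (λ c a b → 𝟙-∨₃-∧ (v ≐ a) (v ≐ c) (v ≐ b) (W a c b)) ⟩
    ∑³ (λ c a b → from-v c a b + at-v c a b + into-v c a b)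
      ≡⟨ ∑³-distrib-+₃ from-v at-v into-v ⟩
    ∑³ from-v + ∑³ at-v + ∑³ into-v
      ≤⟨ +-mono-≤ (+-mono-≤ from-v-≤ at-v-≤) into-v-≤ ⟩
    n + n + n * ⨆ into ∎
    where
    open ≤-Reasoning
    W : Fin n → Fin n → Fin n → Bool
    W = monoPath G H
    _≐_ : Fin n → Fin n → Bool
    v ≐ x = toℕ v ≡ᵇ toℕ x
    from-v at-v into-v : Fin n → Fin n → Fin n → ℕ
    from-v c a b = 𝟙 ((v ≐ a) ∧ W a c b)
    at-v   c a b = 𝟙 ((v ≐ c) ∧ W a c b)
    into-v c a b = 𝟙 ((v ≐ b) ∧ W a c b)
    into : Fin n → ℕ
    into c = ∑[ a < n ] 𝟙 (W a c v)

    from-v-≤ : ∑³ from-v ≤ n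
    from-v-≤ = begin
      ∑³ from-v                          ≡⟨ ∑³-swap₂₃ from-v ⟩
      ∑³ (λ c b a → from-v c a b)        ≡⟨ sum-cong-≗ (λ c → sum-cong-≗ λ b → ∑-δ v λ a → W a c b) ⟩
      ∑[ c < n ] ∑[ b < n ] 𝟙 (W v c b)  ≤⟨ ∑-≤-* (monoPaths-from-≤1 v) ⟩
      n * 1                              ≡⟨ *-identityʳ n ⟩
      n                                  ∎

    at-v-≤ : ∑³ at-v ≤ n
    at-v-≤ = begin
      ∑³ at-v                            ≡⟨ ∑³-rotate at-v ⟩
      ∑³ (λ a b c → at-v c a b)          ≡⟨ sum-cong-≗ (λ a → sum-cong-≗ λ b → ∑-δ v λ c → W a c b) ⟩
      ∑[ a < n ] ∑[ b < n ] 𝟙 (W a v b)  ≤⟨ at-centre-≤ v ⟩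
      n                                  ∎

    into-v-≤ : ∑³ into-v ≤ n * ⨆ into
    into-v-≤ = begin
      ∑³ into-v                          ≡⟨ sum-cong-≗ (λ c → sum-cong-≗ λ a → ∑-δ v (W a c)) ⟩
      ∑[ c < n ] into c                  ≤⟨ ∑-≤-* (≤-⨆ into) ⟩
      n * ⨆ into                         ∎

k≤n+n+n*d⇒k²≤9n³ : ∀ n d k → d ^ 2 ≤ n → k ≤ n + n + n * d → k ^ 2 ≤ 9 * n ^ 3
k≤n+n+n*d⇒k²≤9n³ zero      d .zero _    z≤n = z≤n
k≤n+n+n*d⇒k²≤9n³ n@(suc _) d k     d²≤n k≤  = begin
  k ^ 2              ≤⟨ ^-monoˡ-≤ 2 (≤-trans k≤ n+n+nd≤3ne) ⟩
  (3 * n * e) ^ 2    ≡⟨ square n e ⟩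
  9 * n ^ 2 * e ^ 2  ≤⟨ *-monoʳ-≤ (9 * n ^ 2) e²≤n ⟩
  9 * n ^ 2 * n      ≡⟨ cube n ⟩
  9 * n ^ 3          ∎
  where
  open ≤-Reasoning
  triple : ∀ n e → n * e + n * e + n * e ≡ 3 * n * e
  triple = solve-∀
  square : ∀ n e → (3 * n * e) * ((3 * n * e) * 1) ≡ 9 * (n * (n * 1)) * (e * (e * 1))
  square = solve-∀
  cube : ∀ n → 9 * (n * (n * 1)) * n ≡ 9 * (n * (n * (n * 1)))
  cube = solve-∀
  e : ℕ
  e = d ⊔ 1
  e²≤n : e ^ 2 ≤ n
  e²≤n with ⊔-sel d 1
  ... | inj₁ e≡d = subst (λ t → t ^ 2 ≤ n) (sym e≡d) d²≤n
  ... | inj₂ e≡1 = subst (λ t → t ^ 2 ≤ n) (sym e≡1) (s≤s z≤n)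
  n≤ne : n ≤ n * e
  n≤ne = ≤-trans (≤-reflexive (sym (*-identityʳ n))) (*-monoʳ-≤ n (m≤n⊔m d 1))
  n+n+nd≤3ne : n + n + n * d ≤ 3 * n * e
  n+n+nd≤3ne = begin
    n + n + n * d          ≤⟨ +-mono-≤ (+-mono-≤ n≤ne n≤ne) (*-monoʳ-≤ n (m≤m⊔n d 1)) ⟩
    n * e + n * e + n * e  ≡⟨ triple n e ⟩
    3 * n * e              ∎

corollaryA9 : (n : ℕ) (G : ECGraph n) (H : Digraph n) →
    ((minColourDeg G ∸ minOutDeg H) ^ 2 ≤ n) →
    (∀ x y → arc H x y ≡ true → adj G x y ≡ true) →
    (∀ u w w′ → arc H u w ≡ true → arc H u w′ ≡ true → col G u w ≡ col G u w′ → w ≡ w′) →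
    (∀ u v → arc H u v ≡ true →
      countF (λ w → arc H w u ∧ (col G u v ≡ᵇ col G u w)) ^ 2 ≤ n) →
    (∀ v → sumF (λ x → countF (λ y → arc H x v ∧ arc H v y ∧ (col G x v ≡ᵇ col G v y))) ≤ n) →
    (count3Sets (bad G H) ≤ 3 * n ^ 2)
    × (∀ v → count3Sets (λ x y z → inS v x y z ∧ bad G H x y z) ^ 2 ≤ 9 * n ^ 3)
corollaryA9 n G H _ arc⇒adj out-colours-distinct in-colour-bound centre-bound = all-sets , sets-through
  where
  open ≤-Reasoning
  open BadSets G H arc⇒adj out-colours-distinct
  W : Fin n → Fin n → Fin n → Bool
  W = monoPath G H

  at-centre-≤ : ∀ c → ∑[ a < n ] ∑[ b < n ] 𝟙 (W a c b) ≤ n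
  at-centre-≤ c = subst (_≤ n) (trans (sumF≡∑ λ a → countF λ b → W a c b)
                                      (sum-cong-≗ λ a → sumF≡∑ λ b → 𝟙 (W a c b)))
                               (centre-bound c)

  all-sets : count3Sets (bad G H) ≤ 3 * n ^ 2
  all-sets = begin
    count3Sets (bad G H)  ≤⟨ bad-sets-≤-monoPaths
                                (λ _ _ _ → true) ((λ _ _ _ → refl) , (λ _ _ _ → refl)) ⟩
    #paths W              ≤⟨ ∑-≤-* at-centre-≤ ⟩
    n * n                 ≤⟨ m≤n*m (n * n) 3 ⟩
    3 * (n * n)           ≡⟨ cong (λ t → 3 * (n * t)) (*-identityʳ n) ⟨
    3 * n ^ 2             ∎

  sets-through : ∀ v → count3Sets (λ x y z → inS v x y z ∧ bad G H x y z) ^ 2 ≤ 9 * n ^ 3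
  sets-through v = k≤n+n+n*d⇒k²≤9n³ n (⨆ into) _
    (⨆-closed (λ d → d ^ 2 ≤ n) into z≤n λ c → monoPaths-into-sq-≤ G H c v (in-colour-bound c v))
    (≤-trans (bad-sets-≤-monoPaths (inS v) (inS-symmetric v))
             (#paths-through-≤ v at-centre-≤))
    where
    into : Fin n → ℕ
    into c = ∑[ a < n ] 𝟙 (W a c v)
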